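{- Let $\mathbf{L}$ be a consistent predicate modal logic that admits countably many pairs, each consisting of axiom schemata $\alpha\supset\beta_i$ ($i\in\omega$) and the $\omega$-rule $\frac{p\supset\beta_i\ (i\in\omega)}{p\supset\alpha}$ with $\alpha,\beta_i$ closed, each pair satisfying that $\{\{s(\beta_i)\mid i\in\omega\}\mid s\in\mathsf{Sub}\}$ is countable. Let $A=A(\mathbf{L})$ be its Lindenbaum algebra and $S$ the set defined below. (1) If $\mathsf{Frm}_S(A)\in\mathscr{C}(\mathbf{L})$, then $\mathbf{L}$ is sound and complete with respect to $\mathscr{C}(\mathbf{L})$. (2) Suppose $\mathbf{L}$ satisfies $\mathrm{MT}$. If there exists a neighborhood system $\mathcal{N}$ on $Q_S(A)$ satisfying, for every $F\in Q_S(A)$, $$\Box^{ -1}F\subseteq\bigcup_{X\in\mathcal{N}(F)}\bigcap X,\qquad \Diamond^{ -1}F\subseteq\bigcap_{X\in\mathcal{N}(F)}\bigcup X,$$ such that $\mathsf{Frm}_{S,\mathcal{N}}(A)\in\mathscr{C}(\mathbf{L})$, then $\mathbf{L}$ is sound and complete with respect to $\mathscr{C}(\mathbf{L})$.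
   Context: Language: countable set $\mathsf{V}$ of variables, $\top,\bot,\land,\neg,\forall$, countably many predicate symbols of each arity, modal operator $\Box$, $\Diamond=\neg\Box\neg$. $\mathsf{Sub}$ is the set of uniform substitutions of formulas for predicate symbols. A predicate modal logic is a set $\mathbf{L}$ of formulas containing classical predicate tautologies, closed under modus ponens, uniform substitution, generalization, and the rule $\phi\equiv\psi\in\mathbf{L}\Rightarrow\Box\phi\equiv\Box\psi\in\mathbf{L}$; consistent if $\bot\notin\mathbf{L}$; MT if $\Box(p\land q)\supset\Box p\land\Box q\in\mathbf{L}$. $\mathbf{L}$ admits a pair if for all $s\in\mathsf{Sub}$: $s(\alpha\supset\beta_i)\in\mathbf{L}$ for all $i$, and for every formula $\phi$, $\phi\supset s(\beta_i)\in\mathbf{L}$ for all $i$ implies $\phi\supset s(\alpha)\in\mathbf{L}$. $A(\mathbf{L})$ is the quotient of formulas by $\phi\sim\psi\iff\phi\equiv\psi\in\mathbf{L}$ with operations induced by connectives and $\Box[\phi]=[\Box\phi]$ (a Boolean algebra with a unary operator). $S=S_1\cup S_2$ where $S_1=\{\{[s(\beta_i)]\mid i\in\omega\}\mid s\in\mathsf{Sub}\}$ (over all admitted pairs) and $S_2=\{\{[[y/x]\phi]\mid y\in\mathsf{V}\}\mid\forall x\phi \text{ a formula}\}$. For a Boolean algebra $A$ and $S\subseteq\mathcal{P}(A)$, a Q-filter for $S$ is a prime filter $F$ such that for every $X\in S$, if $\bigwedge X$ exists in $A$ and $X\subseteq F$ then $\bigwedge X\in F$; $Q_S(A)$ is the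 set of Q-filters for $S$. $\mathsf{Frm}_S(A)=\langle Q_S(A),\mathcal{N}_0\rangle$ with $\mathcal{N}_0(F)=\{\{G\in Q_S(A)\mid x\in G\}\mid\Box x\in F\}$. For $\mathcal{N}$ as in (2), $\mathsf{Frm}_{S,\mathcal{N}}(A)=\langle Q_S(A),\uparrow\mathcal{N}\rangle$, where $(\uparrow\mathcal{N})(F)$ is the upward closure of $\mathcal{N}(F)$ in $\mathcal{P}(Q_S(A))$ under inclusion; $\Box^{ -1}F=\{x\mid\Box x\in F\}$, $\Diamond^{ -1}F=\{x\mid -\Box-x\in F\}$, and for $X\subseteq Q_S(A)$, $\bigcap X$, $\bigcup X$ are the intersection and union of the filters in $X$ as subsets of $A$. A neighborhood frame $\langle C,\mathcal{N}\rangle$ ($C\neq\emptyset$, $\mathcal{N}\colon C\to\mathcal{P}(\mathcal{P}(C))$) validates a formula $\phi$ if for every nonempty constant domain $\mathcal{D}$, interpretation $\mathcal{I}$ ($P^{\mathcal{I}}(c)\subseteq\mathcal{D}^n$) and assignment, the valuation of $\phi$ is $C$, where valuations are defined by: atomic via $\mathcal{I}$, Boolean connectives set-theoretically, $\forall x\phi$ as intersection over $d\in\mathcal{D}$ of values with $x\mapsto d$, and $\Box\phi$ as $\{c\mid v(\phi)\in\mathcal{N}(c)\}$. $\mathscr{C}(\mathbf{L})$ is the class of neighborhood frames validating every formula of $\mathbf{L}$; $\mathbf{L}$ is sound and complete with respect to a class $\mathcal{K}$ if $\mathbf{L}$ equals the set of formulas valid in all frames of $\mathcal{K}$. -}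

module Defs where

open import Level using (Level; 0ℓ) renaming (suc to lsuc)
open import Data.Nat using (ℕ; zero; suc; _<_; _+_; _≡ᵇ_)
open import Data.Bool using (Bool; true; false; _∧_; not; if_then_else_)
open import Data.Vec using (Vec; []; _∷_)
import Data.Vec as Vec
open import Data.Vec.Relation.Unary.All using (All)
open import Data.Product using (Σ; _×_; _,_; proj₁; proj₂)
open import Data.Sum using (_⊎_)
open import Relation.Binary.PropositionalEquality using (_≡_)
open import Relation.Nullary using (¬_)
open import Function.Definitions using (Injective)
import Data.Unit.Polymorphic as U
import Data.Empty.Polymorphic as E

-- Syntax (de Bruijn indices: the countable set V of variables is ℕ;
-- a free variable is an index, ∀' binds index 0 of its body).
-- Predicate symbols of arity n: P^n_k, k : ℕ.

infixr 6 _∧'_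
infixr 5 _∨'_
infixr 4 _⊃_
infix 3 _⇔_

data Fm : Set where
  ⊤' ⊥' : Fm
  atom  : (n k : ℕ) → Vec ℕ n → Fm
  _∧'_  : Fm → Fm → Fm
  ¬'_   : Fm → Fm
  ∀'_   : Fm → Fm
  □_    : Fm → Fm

_⊃_ : Fm → Fm → Fm
φ ⊃ ψ = ¬' (φ ∧' ¬' ψ)

_∨'_ : Fm → Fm → Fm
φ ∨' ψ = ¬' (¬' φ ∧' ¬' ψ)

_⇔_ : Fm → Fm → Fm
φ ⇔ ψ = (φ ⊃ ψ) ∧' (ψ ⊃ φ)

◇_ : Fm → Fm
◇ φ = ¬' (□ (¬' φ))

liftR : (ℕ → ℕ) → ℕ → ℕ
liftR ρ zero    = zero
liftR ρ (suc i) = suc (ρ i)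

rename : (ℕ → ℕ) → Fm → Fm
rename ρ ⊤'            = ⊤'
rename ρ ⊥'            = ⊥'
rename ρ (atom n k xs) = atom n k (Vec.map ρ xs)
rename ρ (φ ∧' ψ)      = rename ρ φ ∧' rename ρ ψ
rename ρ (¬' φ)        = ¬' rename ρ φ
rename ρ (∀' φ)        = ∀' rename (liftR ρ) φ
rename ρ (□ φ)         = □ rename ρ φ

-- [y/x]φ for the quantified formula ∀xφ (here ∀' φ): instantiate the
-- bound variable by the variable y
instantiate : ℕ → Fm → Fm
instantiate y φ = rename σ φ
  where
  σ : ℕ → ℕ
  σ zero    = y
  σ (suc i) = i

-- ∀x φ for a free variable x of φ (binding x)
abst : ℕ → ℕ → ℕ
abst x i = if i ≡ᵇ x then zero else suc i

FreeBelow : ℕ → Fm → Set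
FreeBelow d ⊤'            = U.⊤
FreeBelow d ⊥'            = U.⊤
FreeBelow d (atom n k xs) = All (_< d) xs
FreeBelow d (φ ∧' ψ)      = FreeBelow d φ × FreeBelow d ψ
FreeBelow d (¬' φ)        = FreeBelow d φ
FreeBelow d (∀' φ)        = FreeBelow (suc d) φ
FreeBelow d (□ φ)         = FreeBelow d φ

Closed : Fm → Set
Closed = FreeBelow zero

-- Uniform substitutions of formulas for predicate symbols.
-- s n k is the substituent for P^n_k: its free variables 0..n-1 are the
-- argument places, a free variable n+j is the parameter (free variable) j.
-- Substitution is capture avoiding (parameters are shifted under binders).

Sub : Set
Sub = ℕ → ℕ → Fm

argRen : (n : ℕ) → ℕ → Vec ℕ n → ℕ → ℕ
argRen zero    d []       i       = i + d
argRen (suc n) d (x ∷ xs) zero    = x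
argRen (suc n) d (x ∷ xs) (suc i) = argRen n d xs i

psub : Sub → ℕ → Fm → Fm
psub s d ⊤'            = ⊤'
psub s d ⊥'            = ⊥'
psub s d (atom n k xs) = rename (argRen n d xs) (s n k)
psub s d (φ ∧' ψ)      = psub s d φ ∧' psub s d ψ
psub s d (¬' φ)        = ¬' psub s d φ
psub s d (∀' φ)        = ∀' psub s (suc d) φ
psub s d (□ φ)         = □ psub s d φ

subst : Sub → Fm → Fm
subst s = psub s zero

-- Classical predicate logic: propositional tautologies (atomic,
-- quantified and boxed formulas treated as propositional atoms) and the
-- quantifier axioms; together with MP and generalization these give all
-- classical predicate tautologies.

evalB : (Fm → Bool) → Fm → Bool
evalB v ⊤'            = true
evalB v ⊥'            = false
evalB v (atom n k xs) = v (atom n k xs)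
evalB v (φ ∧' ψ)      = evalB v φ ∧ evalB v ψ
evalB v (¬' φ)        = not (evalB v φ)
evalB v (∀' φ)        = v (∀' φ)
evalB v (□ φ)         = v (□ φ)

Taut : Fm → Set
Taut φ = (v : Fm → Bool) → evalB v φ ≡ true

data ClassAx : Fm → Set where
  taut : ∀ {φ} → Taut φ → ClassAx φ
  dist : ∀ {φ ψ} → ClassAx (∀' (φ ⊃ ψ) ⊃ (∀' φ ⊃ ∀' ψ))
  vac  : ∀ {φ} → ClassAx (φ ⊃ ∀' rename suc φ)
  inst : ∀ {φ} y → ClassAx (∀' φ ⊃ instantiate y φ)

record IsPML (L : Fm → Set) : Set where
  field
    cpc : ∀ φ → ClassAx φ → L φ
    mp  : ∀ φ ψ → L φ → L (φ ⊃ ψ) → L ψ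
    us  : ∀ φ (s : Sub) → L φ → L (subst s φ)
    gen : ∀ φ (x : ℕ) → L φ → L (∀' rename (abst x) φ)
    re  : ∀ φ ψ → L (φ ⇔ ψ) → L (□ φ ⇔ □ ψ)

Consistent : (Fm → Set) → Set
Consistent L = ¬ L ⊥'

-- propositional variables p, q: 0-ary predicate symbols P^0_0, P^0_1
MT : (Fm → Set) → Set
MT L = L (□ (p ∧' q) ⊃ (□ p ∧' □ q))
  where
  p q : Fm
  p = atom 0 0 []
  q = atom 0 1 []

Admits : (Fm → Set) → Fm → (ℕ → Fm) → Set
Admits L α β = (s : Sub) →
    ((i : ℕ) → L (subst s (α ⊃ β i)))
  × ((φ : Fm) → ((i : ℕ) → L (φ ⊃ subst s (β i))) → L (φ ⊃ subst s α))

-- Lindenbaum algebra A(L): formulas modulo φ ~ ψ ⇔ φ ≡ ψ ∈ L.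

_~[_]_ : Fm → (Fm → Set) → Fm → Set
φ ~[ L ] ψ = L (φ ⇔ ψ)

_≤[_]_ : Fm → (Fm → Set) → Fm → Set
φ ≤[ L ] ψ = (φ ∧' ψ) ~[ L ] φ

SameSet : (Fm → Set) → (ℕ → Fm) → (ℕ → Fm) → Set
SameSet L X Y = ((i : ℕ) → Σ ℕ λ k → X i ~[ L ] Y k)
              × ((k : ℕ) → Σ ℕ λ i → Y k ~[ L ] X i)

CountableInst : (Fm → Set) → (ℕ → Fm) → Set
CountableInst L β = Σ (ℕ → Sub) λ g → (s : Sub) →
  Σ ℕ λ m → SameSet L (λ i → subst s (β i)) (λ i → subst (g m) (β i))

IsInf : (Fm → Set) → (ℕ → Fm) → Fm → Set
IsInf L X a = ((i : ℕ) → a ≤[ L ] X i)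
            × ((b : Fm) → ((i : ℕ) → b ≤[ L ] X i) → b ≤[ L ] a)

-- prime filters of A(L) (as subsets of formulas closed under ~)
record IsPrimeFilter (L : Fm → Set) (F : Fm → Set) : Set where
  field
    top    : F ⊤'
    up     : ∀ φ ψ → F φ → φ ≤[ L ] ψ → F ψ
    meet   : ∀ φ ψ → F φ → F ψ → F (φ ∧' ψ)
    proper : ¬ F ⊥'
    prime  : ∀ φ ψ → F (φ ∨' ψ) → F φ ⊎ F ψ

QCond : (Fm → Set) → (Fm → Set) → (ℕ → Fm) → Set
QCond L F X = (a : Fm) → IsInf L X a → ((i : ℕ) → F (X i)) → F a

-- Q-filters for S = S₁ ∪ S₂, where S₁ comes from the pairs with
-- consequents β j (j : I) and S₂ = {{[[y/x]φ] | y ∈ V} | ∀xφ formula}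
IsQFilter : (Fm → Set) → {I : Set} → (I → ℕ → Fm) → (Fm → Set) → Set
IsQFilter L {I} β F = IsPrimeFilter L F
  × ((j : I) (s : Sub) → QCond L F (λ i → subst s (β j i)))
  × ((φ : Fm) → QCond L F (λ y → instantiate y φ))

QS : (Fm → Set) → {I : Set} → (I → ℕ → Fm) → Set₁
QS L β = Σ (Fm → Set) (IsQFilter L β)


-- Neighborhood frames and their validity (set-theoretic subsets are
-- predicates; neighborhood membership must be extensional).

_⇔ₛ_ : ∀ {a b} → Set a → Set b → Set (a Level.⊔ b)
A ⇔ₛ B = (A → B) × (B → A)

record NFrame : Set₃ where
  field
    W     : Set₁
    N     : W → (W → Set₂) → Set₂
    N-ext : ∀ {w X Y} → ((u : W) → X u ⇔ₛ Y u) → N w X → N w Y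

module _ (𝔉 : NFrame) where
  open NFrame 𝔉

  _∷ₐ_ : {D : Set₂} → D → (ℕ → D) → ℕ → D
  (d ∷ₐ ρ) zero    = d
  (d ∷ₐ ρ) (suc i) = ρ i

  ⟦_⟧ : Fm → (D : Set₂) → ((n k : ℕ) → W → Vec D n → Set₂) → (ℕ → D) → W → Set₂
  ⟦ ⊤' ⟧          D I ρ w = U.⊤
  ⟦ ⊥' ⟧          D I ρ w = E.⊥
  ⟦ atom n k xs ⟧ D I ρ w = I n k w (Vec.map ρ xs)
  ⟦ φ ∧' ψ ⟧      D I ρ w = ⟦ φ ⟧ D I ρ w × ⟦ ψ ⟧ D I ρ w
  ⟦ ¬' φ ⟧        D I ρ w = ¬ ⟦ φ ⟧ D I ρ w
  ⟦ ∀' φ ⟧        D I ρ w = (d : D) → ⟦ φ ⟧ D I (d ∷ₐ ρ) w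
  ⟦ □ φ ⟧         D I ρ w = N w (λ u → ⟦ φ ⟧ D I ρ u)

  Valid : Fm → Set₃
  Valid φ = (D : Set₂) → D → (I : (n k : ℕ) → W → Vec D n → Set₂)
          → (ρ : ℕ → D) → (w : W) → ⟦ φ ⟧ D I ρ w

-- 𝔉 ∈ 𝒞(L): a (nonempty) neighborhood frame validating every formula of L
InC : (Fm → Set) → NFrame → Set₃
InC L 𝔉 = NFrame.W 𝔉 × ((φ : Fm) → L φ → Valid 𝔉 φ)

SoundComplete : (Fm → Set) → Set₃
SoundComplete L = (φ : Fm) →
  (L φ → (𝔉 : NFrame) → InC L 𝔉 → Valid 𝔉 φ)
  × (((𝔉 : NFrame) → InC L 𝔉 → Valid 𝔉 φ) → L φ)

FrmS : (L : Fm → Set) → {I : Set} → (I → ℕ → Fm) → NFrame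
FrmS L β = record
  { W     = QS L β
  ; N     = N₀
  ; N-ext = λ {w} {X} {Y} → ext {w} {X} {Y}
  }
  where
  N₀ : QS L β → (QS L β → Set₂) → Set₂
  N₀ F X = Σ Fm λ x → (proj₁ F (□ x)) × ((G : QS L β) → X G ⇔ₛ (proj₁ G x))
  ext : ∀ {w X Y} → ((u : QS L β) → X u ⇔ₛ Y u) → N₀ w X → N₀ w Y
  ext e (x , bx , h) =
    x , bx , λ G → (λ y → proj₁ (h G) (proj₂ (e G) y))
                 , (λ g → proj₁ (e G) (proj₂ (h G) g))

NbhdSys : (L : Fm → Set) → {I : Set} → (I → ℕ → Fm) → Set₃
NbhdSys L β = QS L β → (QS L β → Set₁) → Set₂

NbhdCond : (L : Fm → Set) → {I : Set} → (β : I → ℕ → Fm) → NbhdSys L β → Set₂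
NbhdCond L β 𝒩 = (F : QS L β) →
    ((x : Fm) → proj₁ F (□ x) →
       Σ (QS L β → Set₁) λ X → 𝒩 F X × ((G : QS L β) → X G → proj₁ G x))
  × ((x : Fm) → proj₁ F (◇ x) →
       (X : QS L β → Set₁) → 𝒩 F X → Σ (QS L β) λ G → X G × proj₁ G x)

FrmSN : (L : Fm → Set) → {I : Set} → (β : I → ℕ → Fm) → NbhdSys L β → NFrame
FrmSN L β 𝒩 = record
  { W     = QS L β
  ; N     = ↑𝒩
  ; N-ext = λ {w} {X} {Y} → ext {w} {X} {Y}
  }
  where
  ↑𝒩 : QS L β → (QS L β → Set₂) → Set₂
  ↑𝒩 F Y = Σ (QS L β → Set₁) λ X → 𝒩 F X × ((G : QS L β) → X G → Y G)
  ext : ∀ {w X Y} → ((u : QS L β) → X u ⇔ₛ Y u) → ↑𝒩 w X → ↑𝒩 w Y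
  ext e (X , nX , sub) = X , nX , λ G g → proj₁ (e G) (sub G g)

-- Soundness holds by the definition of 𝒞(L); the content is completeness. By the
-- Rasiowa–Sikorski lemma, run along enumerations of the formulas and of the countably
-- many families in S (the instances of each ∀xφ, and one representative of each
-- S₁-family up to SameSet), every L-consistent formula lies in a Q-filter; hence
-- a ⊃ b ∈ L as soon as every Q-filter containing a contains b. In the canonical model
-- on Q_S(A), whose domain is the set of variables, a formula holds at G iff it lies
-- in G: for ∀ this is the Q-condition for S₂, ∀xφ being the infimum of its instances;
-- for □ it follows from separation and the rule RE for 𝒩₀, and from the two
-- inclusions assumed of 𝒩 for ↑𝒩. So a formula valid on a canonical frame lying in
-- 𝒞(L) belongs to L.

{-# OPTIONS --safe #-}
module Submission where

open import Defs
open import Level using (Level)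
open import Data.Nat using (ℕ)
open import Data.Product using (_×_)
open import Function.Definitions using (Injective)
open import Relation.Binary.PropositionalEquality using (_≡_)
open import Axiom.ExcludedMiddle using (ExcludedMiddle)

open import Level using (Lift; lift; lower; 0ℓ) renaming (suc to lsuc)
open import Data.Nat using (zero; suc; _+_; _⊔_; _≤_; _<_; _≤′_; ≤′-refl; ≤′-step; s≤s; _≡ᵇ_)
open import Data.Nat.Properties
  using (≤-refl; ≤-trans; ≤⇒≤′; m≤m⊔n; m≤n⊔m; m⊔n≤o⇒m≤o; m⊔n≤o⇒n≤o; n≤1+n; +-suc; +-identityʳ; suc-injective;
         <⇒≢; ≡ᵇ⇒≡; ≡⇒≡ᵇ)
open import Data.Product using (Σ; ∃; _,_; proj₁; proj₂; uncurry)
open import Data.Bool using (Bool; true; false; T; _∧_; not)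
open import Data.Bool.Properties using (T-≡)
open import Data.Fin using (Fin; zero; suc)
open import Data.Vec using (Vec; []; _∷_)
import Data.Vec as Vec
import Data.Vec.Properties as Vec
open import Data.Vec.Relation.Unary.All using (All; []; _∷_)
import Data.Vec.Relation.Unary.All as All
open import Data.Empty using (⊥; ⊥-elim)
open import Data.Maybe using (Maybe; just; nothing)
open import Data.Sum using (_⊎_; inj₁; inj₂)
import Data.Sum as Sum
open import Relation.Nullary using (¬_; contradiction; Dec; yes; no)
open import Relation.Nullary.Decidable using (map′; decidable-stable)
open import Function using (id; _∘_)
open import Function.Bundles using (Equivalence)
open import Function.Definitions using (StrictlySurjective)
open import Relation.Binary.PropositionalEquality
  using (refl; sym; trans; cong; cong₂; _≗_; module ≡-Reasoning)
  renaming (subst to transport)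

-- Renaming of variables

rename-cong-below : ∀ {f g} d φ → FreeBelow d φ → (∀ i → i < d → f i ≡ g i)
                  → rename f φ ≡ rename g φ
rename-cong-below d ⊤'            _         f≗g = refl
rename-cong-below d ⊥'            _         f≗g = refl
rename-cong-below {f} {g} d (atom n k xs) xs<d f≗g = cong (atom n k) (map-cong xs<d)
  where
  map-cong : ∀ {m} {ys : Vec ℕ m} → All (_< d) ys → Vec.map f ys ≡ Vec.map g ys
  map-cong []          = refl
  map-cong (y<d ∷ ys<d) = cong₂ _∷_ (f≗g _ y<d) (map-cong ys<d)
rename-cong-below d (φ ∧' ψ)      (fφ , fψ) f≗g =
  cong₂ _∧'_ (rename-cong-below d φ fφ f≗g) (rename-cong-below d ψ fψ f≗g)
rename-cong-below d (¬' φ)        fφ        f≗g = cong ¬'_ (rename-cong-below d φ fφ f≗g)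
rename-cong-below d (∀' φ)        fφ        f≗g =
  cong ∀'_ (rename-cong-below (suc d) φ fφ
    λ { zero _ → refl ; (suc i) (s≤s i<d) → cong suc (f≗g i i<d) })
rename-cong-below d (□ φ)         fφ        f≗g = cong □_ (rename-cong-below d φ fφ f≗g)

FreeBelow-mono : ∀ {d e} φ → d ≤ e → FreeBelow d φ → FreeBelow e φ
FreeBelow-mono ⊤'            d≤e _         = _
FreeBelow-mono ⊥'            d≤e _         = _
FreeBelow-mono (atom n k xs) d≤e xs<d      = All.map (λ x<d → ≤-trans x<d d≤e) xs<d
FreeBelow-mono (φ ∧' ψ)      d≤e (fφ , fψ) = FreeBelow-mono φ d≤e fφ , FreeBelow-mono ψ d≤e fψ
FreeBelow-mono (¬' φ)        d≤e fφ        = FreeBelow-mono φ d≤e fφ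
FreeBelow-mono (∀' φ)        d≤e fφ        = FreeBelow-mono φ (s≤s d≤e) fφ
FreeBelow-mono (□ φ)         d≤e fφ        = FreeBelow-mono φ d≤e fφ

freeBound : ∀ φ → ∃ λ d → FreeBelow d φ
freeBound ⊤'            = 0 , _
freeBound ⊥'            = 0 , _
freeBound (atom n k xs) = strictBound xs , all<strictBound xs
  where
  strictBound : ∀ {m} → Vec ℕ m → ℕ
  strictBound []       = 0
  strictBound (y ∷ ys) = suc y ⊔ strictBound ys
  all<strictBound : ∀ {m} (ys : Vec ℕ m) → All (_< strictBound ys) ys
  all<strictBound []       = []
  all<strictBound (y ∷ ys) =
    m≤m⊔n (suc y) (strictBound ys) ∷ All.map (λ y<d → ≤-trans y<d (m≤n⊔m (suc y) _)) (all<strictBound ys)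
freeBound (φ ∧' ψ) with freeBound φ | freeBound ψ
... | d , fφ | e , fψ = d ⊔ e , FreeBelow-mono φ (m≤m⊔n d e) fφ , FreeBelow-mono ψ (m≤n⊔m d e) fψ
freeBound (¬' φ)        = freeBound φ
freeBound (∀' φ)        = let d , fφ = freeBound φ in d , FreeBelow-mono φ (n≤1+n d) fφ
freeBound (□ φ)         = freeBound φ

rename-cong : ∀ {f g} → f ≗ g → rename f ≗ rename g
rename-cong f≗g φ = let d , fφ = freeBound φ in rename-cong-below d φ fφ (λ i _ → f≗g i)

rename-∘ : ∀ f g φ → rename f (rename g φ) ≡ rename (f ∘ g) φ
rename-∘ f g ⊤'            = refl
rename-∘ f g ⊥'            = refl
rename-∘ f g (atom n k xs) = cong (atom n k) (sym (Vec.map-∘ f g xs))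
rename-∘ f g (φ ∧' ψ)      = cong₂ _∧'_ (rename-∘ f g φ) (rename-∘ f g ψ)
rename-∘ f g (¬' φ)        = cong ¬'_ (rename-∘ f g φ)
rename-∘ f g (∀' φ)        =
  cong ∀'_ (trans (rename-∘ (liftR f) (liftR g) φ) (rename-cong (λ { zero → refl ; (suc i) → refl }) φ))
rename-∘ f g (□ φ)         = cong □_ (rename-∘ f g φ)

rename-id : ∀ φ → rename id φ ≡ φ
rename-id ⊤'            = refl
rename-id ⊥'            = refl
rename-id (atom n k xs) = cong (atom n k) (Vec.map-id xs)
rename-id (φ ∧' ψ)      = cong₂ _∧'_ (rename-id φ) (rename-id ψ)
rename-id (¬' φ)        = cong ¬'_ (rename-id φ)
rename-id (∀' φ)        =
  cong ∀'_ (trans (rename-cong (λ { zero → refl ; (suc i) → refl }) φ) (rename-id φ))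
rename-id (□ φ)         = cong □_ (rename-id φ)

infixr 5 _∷ᵣ_
_∷ᵣ_ : ℕ → (ℕ → ℕ) → ℕ → ℕ
(y ∷ᵣ ρ) zero    = y
(y ∷ᵣ ρ) (suc i) = ρ i

instantiate-as-rename : ∀ y → instantiate y ≗ rename (y ∷ᵣ id)
instantiate-as-rename y φ = rename-cong (λ { zero → refl ; (suc i) → refl }) φ

instantiate-rename : ∀ y ρ φ → instantiate y (rename (liftR ρ) φ) ≡ rename (y ∷ᵣ ρ) φ
instantiate-rename y ρ φ =
  trans (instantiate-as-rename y (rename (liftR ρ) φ))
        (trans (rename-∘ (y ∷ᵣ id) (liftR ρ) φ) (rename-cong (λ { zero → refl ; (suc i) → refl }) φ))

abst-fresh : ∀ {x i} → i < x → abst x i ≡ suc i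
abst-fresh {x} {i} i<x with i ≡ᵇ x in eq
... | true  = contradiction (≡ᵇ⇒≡ i x (transport T (sym eq) _)) (<⇒≢ i<x)
... | false = refl

abst-self : ∀ x → abst x x ≡ zero
abst-self x with x ≡ᵇ x in eq
... | true  = refl
... | false = ⊥-elim (transport T eq (≡⇒≡ᵇ x x refl))

rename-abst-fresh : ∀ x φ → FreeBelow x φ → rename (abst x) φ ≡ rename suc φ
rename-abst-fresh x φ fφ = rename-cong-below x φ fφ (λ i → abst-fresh)

abst-instantiate : ∀ x φ → FreeBelow (suc x) φ → rename (abst x) (instantiate x φ) ≡ φ
abst-instantiate x φ fφ = begin
  rename (abst x) (instantiate x φ)     ≡⟨ cong (rename (abst x)) (instantiate-as-rename x φ) ⟩
  rename (abst x) (rename (x ∷ᵣ id) φ)  ≡⟨ rename-∘ (abst x) (x ∷ᵣ id) φ ⟩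
  rename (abst x ∘ (x ∷ᵣ id)) φ         ≡⟨ rename-cong-below (suc x) φ fφ undo ⟩
  rename id φ                           ≡⟨ rename-id φ ⟩
  φ                                     ∎
  where
  open ≡-Reasoning
  undo : ∀ i → i < suc x → abst x ((x ∷ᵣ id) i) ≡ i
  undo zero    _         = abst-self x
  undo (suc i) (s≤s i<x) = abst-fresh i<x

-- Countability of formulas

-- Cantor's enumeration: walk each antidiagonal a + b = s from (0 , s) down to (s , 0).
zigzag : ℕ × ℕ → ℕ × ℕ
zigzag (a , zero)  = 0 , suc a
zigzag (a , suc b) = suc a , b

unpair : ℕ → ℕ × ℕ
unpair zero    = 0 , 0
unpair (suc n) = zigzag (unpair n)

unpair-surjective : StrictlySurjective _≡_ unpair
unpair-surjective (a , b) = diagonal (a + b) a b refl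
  where
  diagonal : ∀ s a b → a + b ≡ s → ∃ λ n → unpair n ≡ (a , b)
  diagonal s       zero    zero    _  = 0 , refl
  diagonal s       (suc a) b       eq =
    let n , eq′ = diagonal s a (suc b) (trans (+-suc a b) eq) in suc n , cong zigzag eq′
  diagonal (suc s) zero    (suc b) eq =
    let n , eq′ = diagonal s b zero (trans (+-identityʳ b) (suc-injective eq)) in suc n , cong zigzag eq′

pair : ℕ → ℕ → ℕ
pair a b = proj₁ (unpair-surjective (a , b))

unpair-pair : ∀ a b → unpair (pair a b) ≡ (a , b)
unpair-pair a b = proj₂ (unpair-surjective (a , b))

decodeVec : ∀ n → ℕ → Vec ℕ n
decodeVec zero    c = []
decodeVec (suc n) c = proj₁ (unpair c) ∷ decodeVec n (proj₂ (unpair c))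

decodeVec-surjective : ∀ {n} → StrictlySurjective _≡_ (decodeVec n)
decodeVec-surjective []       = 0 , refl
decodeVec-surjective (x ∷ xs) with decodeVec-surjective xs
... | c , refl = pair x c , cong (λ (y , c′) → y ∷ decodeVec _ c′) (unpair-pair x c)

-- In decode f c, f is fuel bounding the depth; tags 0–6 of unpair c select the
-- constructor, and out-of-range tags or exhausted fuel give the junk value ⊤'.
mutual
  decode : ℕ → ℕ → Fm
  decode zero    c = ⊤'
  decode (suc f) c = decodeNode f (unpair c)

  decodeNode : ℕ → ℕ × ℕ → Fm
  decodeNode f (0 , c) = ⊤'
  decodeNode f (1 , c) = ⊥'
  decodeNode f (2 , c) = let n , c′ = unpair c ; k , c″ = unpair c′ in atom n k (decodeVec n c″)
  decodeNode f (3 , c) = decode f (proj₁ (unpair c)) ∧' decode f (proj₂ (unpair c))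
  decodeNode f (4 , c) = ¬' decode f c
  decodeNode f (5 , c) = ∀' decode f c
  decodeNode f (6 , c) = □ decode f c
  decodeNode f (_ , c) = ⊤'

depth : Fm → ℕ
depth (φ ∧' ψ) = suc (depth φ ⊔ depth ψ)
depth (¬' φ)   = suc (depth φ)
depth (∀' φ)   = suc (depth φ)
depth (□ φ)    = suc (depth φ)
depth _        = 1

encode : Fm → ℕ
encode ⊤'            = pair 0 0
encode ⊥'            = pair 1 0
encode (atom n k xs) = pair 2 (pair n (pair k (proj₁ (decodeVec-surjective xs))))
encode (φ ∧' ψ)      = pair 3 (pair (encode φ) (encode ψ))
encode (¬' φ)        = pair 4 (encode φ)
encode (∀' φ)        = pair 5 (encode φ)
encode (□ φ)         = pair 6 (encode φ)

decode-encode : ∀ φ {f} → depth φ ≤ f → decode f (encode φ) ≡ φ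
decode-encode ⊤' (s≤s _) rewrite unpair-pair 0 0 = refl
decode-encode ⊥' (s≤s _) rewrite unpair-pair 1 0 = refl
decode-encode (atom n k xs) (s≤s _) with decodeVec-surjective xs
... | c , refl rewrite unpair-pair 2 (pair n (pair k c)) | unpair-pair n (pair k c) | unpair-pair k c = refl
decode-encode (φ ∧' ψ) (s≤s d≤f)
  rewrite unpair-pair 3 (pair (encode φ) (encode ψ)) | unpair-pair (encode φ) (encode ψ) =
  cong₂ _∧'_ (decode-encode φ (m⊔n≤o⇒m≤o _ _ d≤f)) (decode-encode ψ (m⊔n≤o⇒n≤o _ _ d≤f))
decode-encode (¬' φ) (s≤s d≤f) rewrite unpair-pair 4 (encode φ) = cong ¬'_ (decode-encode φ d≤f)
decode-encode (∀' φ) (s≤s d≤f) rewrite unpair-pair 5 (encode φ) = cong ∀'_ (decode-encode φ d≤f)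
decode-encode (□ φ)  (s≤s d≤f) rewrite unpair-pair 6 (encode φ) = cong □_ (decode-encode φ d≤f)

enumFm : ℕ → Fm
enumFm = uncurry decode ∘ unpair

enumFm-surjective : StrictlySurjective _≡_ enumFm
enumFm-surjective φ =
  pair (depth φ) (encode φ) ,
  trans (cong (uncurry decode) (unpair-pair (depth φ) (encode φ))) (decode-encode φ ≤-refl)

-- Propositional tautologies, checked by truth tables

infixr 6 _∧ₚ_

data Schema (n : ℕ) : Set where
  var     : Fin n → Schema n
  ⊤ₚ ⊥ₚ   : Schema n
  _∧ₚ_    : Schema n → Schema n → Schema n
  ¬ₚ_     : Schema n → Schema n

module _ {n : ℕ} where
  infixr 5 _∨ₚ_
  infixr 4 _⊃ₚ_
  infix  3 _⇔ₚ_
  infix  25 _[_]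

  _⊃ₚ_ _∨ₚ_ _⇔ₚ_ : Schema n → Schema n → Schema n
  S ⊃ₚ R = ¬ₚ (S ∧ₚ ¬ₚ R)
  S ∨ₚ R = ¬ₚ (¬ₚ S ∧ₚ ¬ₚ R)
  S ⇔ₚ R = (S ⊃ₚ R) ∧ₚ (R ⊃ₚ S)

  _[_] : Schema n → Vec Fm n → Fm
  var i    [ φs ] = Vec.lookup φs i
  ⊤ₚ       [ φs ] = ⊤'
  ⊥ₚ       [ φs ] = ⊥'
  (S ∧ₚ R) [ φs ] = S [ φs ] ∧' R [ φs ]
  (¬ₚ S)   [ φs ] = ¬' S [ φs ]

  evalₚ : Schema n → Vec Bool n → Bool
  evalₚ (var i)  bs = Vec.lookup bs i
  evalₚ ⊤ₚ       bs = true
  evalₚ ⊥ₚ       bs = false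
  evalₚ (S ∧ₚ R) bs = evalₚ S bs ∧ evalₚ R bs
  evalₚ (¬ₚ S)   bs = not (evalₚ S bs)

  evalB-[] : ∀ v S φs → evalB v (S [ φs ]) ≡ evalₚ S (Vec.map (evalB v) φs)
  evalB-[] v (var i)  φs = sym (Vec.lookup-map i (evalB v) φs)
  evalB-[] v ⊤ₚ       φs = refl
  evalB-[] v ⊥ₚ       φs = refl
  evalB-[] v (S ∧ₚ R) φs = cong₂ _∧_ (evalB-[] v S φs) (evalB-[] v R φs)
  evalB-[] v (¬ₚ S)   φs = cong not (evalB-[] v S φs)

x₀ : ∀ {n} → Schema (suc n)
x₀ = var zero

x₁ : ∀ {n} → Schema (suc (suc n))
x₁ = var (suc zero)

x₂ : ∀ {n} → Schema (suc (suc (suc n)))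
x₂ = var (suc (suc zero))

AllTrue : ∀ n → (Vec Bool n → Bool) → Set
AllTrue zero    f = T (f [])
AllTrue (suc n) f = AllTrue n (f ∘ (true ∷_)) × AllTrue n (f ∘ (false ∷_))

AllTrue-sound : ∀ n f → AllTrue n f → ∀ bs → f bs ≡ true
AllTrue-sound zero    f t       []           = Equivalence.to T-≡ t
AllTrue-sound (suc n) f (t , _) (true ∷ bs)  = AllTrue-sound n (f ∘ (true ∷_)) t bs
AllTrue-sound (suc n) f (_ , t) (false ∷ bs) = AllTrue-sound n (f ∘ (false ∷_)) t bs

IsTautology : ∀ {n} → Schema n → Set
IsTautology {n} S = AllTrue n (evalₚ S)

instance-taut : ∀ {n} (S : Schema n) → IsTautology S → ∀ φs → Taut (S [ φs ])
instance-taut S valid φs v = trans (evalB-[] v S φs) (AllTrue-sound _ (evalₚ S) valid _)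

-- Derived rules of a predicate modal logic

module Derivations {L : Fm → Set} (isL : IsPML L) where
  open IsPML isL

  infix 3 _⊢_
  _⊢_ : Fm → Fm → Set
  a ⊢ b = L (a ⊃ b)

  -- For a valid closed schema, IsTautology S normalises to a product of ⊤s,
  -- so the implicit truth-table check is solved by Agda itself.
  tautology : ∀ {n} (S : Schema n) {valid : IsTautology S} φs → L (S [ φs ])
  tautology S {valid} φs = cpc _ (taut (instance-taut S valid φs))

  mp₁ : ∀ {a b} → L (a ⊃ b) → L a → L b
  mp₁ {a} {b} ⊢a⊃b ⊢a = mp a b ⊢a ⊢a⊃b

  mp₂ : ∀ {a b c} → L (a ⊃ b ⊃ c) → L a → L b → L c
  mp₂ ⊢a⊃b⊃c ⊢a = mp₁ (mp₁ ⊢a⊃b⊃c ⊢a)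

  ⊢-refl : ∀ {a} → a ⊢ a
  ⊢-refl {a} = tautology (x₀ ⊃ₚ x₀) (a ∷ [])

  ⊢-trans : ∀ {a b c} → a ⊢ b → b ⊢ c → a ⊢ c
  ⊢-trans {a} {b} {c} = mp₂ (tautology ((x₀ ⊃ₚ x₁) ⊃ₚ (x₁ ⊃ₚ x₂) ⊃ₚ x₀ ⊃ₚ x₂) (a ∷ b ∷ c ∷ []))

  ⊢⊤ : ∀ {a} → a ⊢ ⊤'
  ⊢⊤ {a} = tautology (x₀ ⊃ₚ ⊤ₚ) (a ∷ [])

  ∧⊢ˡ : ∀ {a b} → a ∧' b ⊢ a
  ∧⊢ˡ {a} {b} = tautology (x₀ ∧ₚ x₁ ⊃ₚ x₀) (a ∷ b ∷ [])

  ∧⊢ʳ : ∀ {a b} → a ∧' b ⊢ b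
  ∧⊢ʳ {a} {b} = tautology (x₀ ∧ₚ x₁ ⊃ₚ x₁) (a ∷ b ∷ [])

  ⊢∧ : ∀ {a b c} → c ⊢ a → c ⊢ b → c ⊢ a ∧' b
  ⊢∧ {a} {b} {c} = mp₂ (tautology ((x₂ ⊃ₚ x₀) ⊃ₚ (x₂ ⊃ₚ x₁) ⊃ₚ x₂ ⊃ₚ x₀ ∧ₚ x₁) (a ∷ b ∷ c ∷ []))

  ≤⇒⊢ : ∀ {a b} → a ≤[ L ] b → a ⊢ b
  ≤⇒⊢ {a} {b} = mp₁ (tautology ((x₀ ∧ₚ x₁ ⇔ₚ x₀) ⊃ₚ x₀ ⊃ₚ x₁) (a ∷ b ∷ []))

  ⊢⇒≤ : ∀ {a b} → a ⊢ b → a ≤[ L ] b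
  ⊢⇒≤ {a} {b} = mp₁ (tautology ((x₀ ⊃ₚ x₁) ⊃ₚ (x₀ ∧ₚ x₁ ⇔ₚ x₀)) (a ∷ b ∷ []))

  ⊢-antisym : ∀ {a b} → a ⊢ b → b ⊢ a → L (a ⇔ b)
  ⊢-antisym {a} {b} = mp₂ (tautology ((x₀ ⊃ₚ x₁) ⊃ₚ (x₁ ⊃ₚ x₀) ⊃ₚ (x₀ ⇔ₚ x₁)) (a ∷ b ∷ []))

  ⇔⇒⊢ : ∀ {a b} → L (a ⇔ b) → a ⊢ b
  ⇔⇒⊢ {a} {b} = mp₁ (tautology ((x₀ ⇔ₚ x₁) ⊃ₚ x₀ ⊃ₚ x₁) (a ∷ b ∷ []))

  ⇔⇒⊢˘ : ∀ {a b} → L (a ⇔ b) → b ⊢ a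
  ⇔⇒⊢˘ {a} {b} = mp₁ (tautology ((x₀ ⇔ₚ x₁) ⊃ₚ x₁ ⊃ₚ x₀) (a ∷ b ∷ []))

  ⊤⊢⇒L : ∀ {a} → ⊤' ⊢ a → L a
  ⊤⊢⇒L ⊤⊢a = mp₁ ⊤⊢a (tautology ⊤ₚ [])

  ⊤⊢∨¬ : ∀ {a} → ⊤' ⊢ a ∨' ¬' a
  ⊤⊢∨¬ {a} = tautology (⊤ₚ ⊃ₚ x₀ ∨ₚ ¬ₚ x₀) (a ∷ [])

  ∧¬⊢⊥ : ∀ {a} → a ∧' ¬' a ⊢ ⊥'
  ∧¬⊢⊥ {a} = tautology (x₀ ∧ₚ ¬ₚ x₀ ⊃ₚ ⊥ₚ) (a ∷ [])

  ¬∧∨⊢ : ∀ {a b} → ¬' a ∧' (a ∨' b) ⊢ b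
  ¬∧∨⊢ {a} {b} = tautology (¬ₚ x₀ ∧ₚ (x₀ ∨ₚ x₁) ⊃ₚ x₁) (a ∷ b ∷ [])

  ⊢⊥-by-cases : ∀ {a c} → c ∧' a ⊢ ⊥' → c ∧' ¬' a ⊢ ⊥' → c ⊢ ⊥'
  ⊢⊥-by-cases {a} {c} =
    mp₂ (tautology ((x₁ ∧ₚ x₀ ⊃ₚ ⊥ₚ) ⊃ₚ (x₁ ∧ₚ ¬ₚ x₀ ⊃ₚ ⊥ₚ) ⊃ₚ x₁ ⊃ₚ ⊥ₚ) (a ∷ c ∷ []))

  ∧¬⊢⊥⇒⊢ : ∀ {a c} → c ∧' ¬' a ⊢ ⊥' → c ⊢ a
  ∧¬⊢⊥⇒⊢ {a} {c} = mp₁ (tautology ((x₁ ∧ₚ ¬ₚ x₀ ⊃ₚ ⊥ₚ) ⊃ₚ x₁ ⊃ₚ x₀) (a ∷ c ∷ []))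

  contraposition : ∀ {a b} → a ⊢ b → ¬' b ⊢ ¬' a
  contraposition {a} {b} = mp₁ (tautology ((x₀ ⊃ₚ x₁) ⊃ₚ ¬ₚ x₁ ⊃ₚ ¬ₚ x₀) (a ∷ b ∷ []))

  ¬¬⇔ : ∀ {a} → L (¬' ¬' a ⇔ a)
  ¬¬⇔ {a} = tautology (¬ₚ ¬ₚ x₀ ⇔ₚ x₀) (a ∷ [])

  □-cong : ∀ {a b} → L (a ⇔ b) → □ a ⊢ □ b
  □-cong {a} {b} a⇔b = ⇔⇒⊢ (re a b a⇔b)

  ≤-⊢-trans : ∀ {a b c} → a ≤[ L ] b → b ⊢ c → a ≤[ L ] c
  ≤-⊢-trans a≤b b⊢c = ⊢⇒≤ (⊢-trans (≤⇒⊢ a≤b) b⊢c)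

  IsInf-SameSet : ∀ {X Y a} → SameSet L X Y → IsInf L X a → IsInf L Y a
  IsInf-SameSet (X⊆Y , Y⊆X) (a≤X , greatest) =
      (λ k → let i , Yk~Xi = Y⊆X k in ≤-⊢-trans (a≤X i) (⇔⇒⊢˘ Yk~Xi))
    , (λ b b≤Y → greatest b (λ i → let k , Xi~Yk = X⊆Y i in ≤-⊢-trans (b≤Y k) (⇔⇒⊢˘ Xi~Yk)))

  ∀-infimum : ∀ ψ → IsInf L (λ y → instantiate y ψ) (∀' ψ)
  ∀-infimum ψ = (λ y → ⊢⇒≤ (cpc _ (inst y))) , greatest
    where
    greatest : ∀ b → (∀ y → b ≤[ L ] instantiate y ψ) → b ≤[ L ] (∀' ψ)
    greatest b b≤ = ⊢⇒≤ (⊢-trans (cpc _ vac) (mp₁ (cpc _ dist) generalised))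
      where
      -- generalise b ⊢ [x/0]ψ over a variable x free in neither b nor ∀'ψ
      db = proj₁ (freeBound b)
      dψ = proj₁ (freeBound (∀' ψ))
      x  = db ⊔ dψ
      generalised : L (∀' (rename suc b ⊃ ψ))
      generalised =
        transport L
          (cong ∀'_ (cong₂ _⊃_
            (rename-abst-fresh x b (FreeBelow-mono b (m≤m⊔n db dψ) (proj₂ (freeBound b))))
            (abst-instantiate x ψ (FreeBelow-mono ψ (s≤s (m≤n⊔m db dψ)) (proj₂ (freeBound (∀' ψ)))))))
          (gen _ x (≤⇒⊢ (b≤ x)))

-- Prime filters of the Lindenbaum algebra

module PrimeFilter {L : Fm → Set} (isL : IsPML L) {F : Fm → Set} (pf : IsPrimeFilter L F) where
  open Derivations isL
  open IsPrimeFilter pf public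

  up⊢ : ∀ {a b} → F a → a ⊢ b → F b
  up⊢ {a} {b} a∈F a⊢b = up a b a∈F (⊢⇒≤ a⊢b)

  not-both : ∀ {a} → F a → F (¬' a) → ⊥
  not-both {a} a∈F ¬a∈F = proper (up⊢ (meet a (¬' a) a∈F ¬a∈F) ∧¬⊢⊥)

  ∈-or-¬∈ : ∀ a → F a ⊎ F (¬' a)
  ∈-or-¬∈ a = prime a (¬' a) (up⊢ top ⊤⊢∨¬)

  QCond-SameSet : ∀ {X Y} → SameSet L X Y → QCond L F Y → QCond L F X
  QCond-SameSet X≈Y qY a a-inf X⊆F =
    qY a (IsInf-SameSet X≈Y a-inf) (λ k → let i , Yk~Xi = proj₂ X≈Y k in up⊢ (X⊆F i) (⇔⇒⊢˘ Yk~Xi))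

-- The Rasiowa–Sikorski lemma

decide : ExcludedMiddle (lsuc (lsuc 0ℓ)) → (P : Set) → Dec P
decide lem P = map′ lower lift lem

module RasiowaSikorski (lem : ExcludedMiddle (lsuc (lsuc 0ℓ))) {L : Fm → Set} (isL : IsPML L)
                       (fam : ℕ → ℕ → Fm) where
  open Derivations isL

  Coherent : Fm → Set
  Coherent c = ¬ (c ⊢ ⊥')

  refine-by-formula : ∀ {c} ψ → Coherent c
                    → ∃ λ c′ → Coherent c′ × c′ ⊢ c × (c′ ⊢ ψ ⊎ c′ ⊢ ¬' ψ)
  refine-by-formula {c} ψ c-coh with decide lem (c ∧' ψ ⊢ ⊥')
  ... | no  coh     = c ∧' ψ , coh , ∧⊢ˡ , inj₁ ∧⊢ʳ
  ... | yes c∧ψ⊢⊥ = c ∧' ¬' ψ , c-coh ∘ ⊢⊥-by-cases c∧ψ⊢⊥ , ∧⊢ˡ , inj₂ ∧⊢ʳ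

  refine-by-family : ∀ {c} (X : ℕ → Fm) → Coherent c
                   → ∃ λ c′ → Coherent c′ × c′ ⊢ c × ((∃ λ i → c′ ⊢ ¬' X i) ⊎ (∀ i → c′ ⊢ X i))
  refine-by-family {c} X c-coh with decide lem (∃ λ i → Coherent (c ∧' ¬' X i))
  ... | yes (i , coh) = c ∧' ¬' X i , coh , ∧⊢ˡ , inj₁ (i , ∧⊢ʳ)
  ... | no  none      = c , c-coh , ⊢-refl , inj₂ λ i →
    ∧¬⊢⊥⇒⊢ (decidable-stable (decide lem _) (λ coh → none (i , coh)))

  record Refinement (c ψ : Fm) (X : ℕ → Fm) : Set where
    field
      next     : Fm
      coherent : Coherent next
      next⊢c   : next ⊢ c
      decides  : next ⊢ ψ ⊎ next ⊢ ¬' ψ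
      meets    : (∃ λ i → next ⊢ ¬' X i) ⊎ (∀ i → next ⊢ X i)

  refine : ∀ {c} ψ (X : ℕ → Fm) → Coherent c → Refinement c ψ X
  refine ψ X c-coh =
    let c₁ , coh₁ , c₁⊢c , decides₁ = refine-by-formula ψ c-coh
        c₂ , coh₂ , c₂⊢c₁ , meets₂  = refine-by-family X coh₁
    in record { next     = c₂
              ; coherent = coh₂
              ; next⊢c   = ⊢-trans c₂⊢c₁ c₁⊢c
              ; decides  = Sum.map (⊢-trans c₂⊢c₁) (⊢-trans c₂⊢c₁) decides₁
              ; meets    = meets₂
              }

  module Generic (χ : Fm) (χ-coherent : Coherent χ) where

    stage : ℕ → Σ Fm Coherent
    refinement : ∀ n → Refinement (proj₁ (stage n)) (enumFm n) (fam n)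

    stage zero    = χ , χ-coherent
    stage (suc n) = Refinement.next (refinement n) , Refinement.coherent (refinement n)

    refinement n = refine (enumFm n) (fam n) (proj₂ (stage n))

    c : ℕ → Fm
    c = proj₁ ∘ stage

    open Refinement

    c-antitone : ∀ {m n} → m ≤′ n → c n ⊢ c m
    c-antitone ≤′-refl         = ⊢-refl
    c-antitone (≤′-step m≤′n) = ⊢-trans (next⊢c (refinement _)) (c-antitone m≤′n)

    G : Fm → Set
    G ψ = ∃ λ n → c n ⊢ ψ

    G-up⊢ : ∀ {a b} → G a → a ⊢ b → G b
    G-up⊢ (n , cn⊢a) a⊢b = n , ⊢-trans cn⊢a a⊢b

    G-meet : ∀ {a b} → G a → G b → G (a ∧' b)
    G-meet (m , cm⊢a) (n , cn⊢b) =
      m ⊔ n , ⊢∧ (⊢-trans (c-antitone (≤⇒≤′ (m≤m⊔n m n))) cm⊢a)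
                 (⊢-trans (c-antitone (≤⇒≤′ (m≤n⊔m m n))) cn⊢b)

    G-decides : ∀ ψ → G ψ ⊎ G (¬' ψ)
    G-decides ψ with enumFm-surjective ψ
    ... | n , refl = Sum.map (suc n ,_) (suc n ,_) (decides (refinement n))

    G-prime : ∀ a b → G (a ∨' b) → G a ⊎ G b
    G-prime a b a∨b∈G with G-decides a
    ... | inj₁ a∈G  = inj₁ a∈G
    ... | inj₂ ¬a∈G = inj₂ (G-up⊢ (G-meet ¬a∈G a∨b∈G) ¬∧∨⊢)

    G-isPrimeFilter : IsPrimeFilter L G
    G-isPrimeFilter = record
      { top    = 0 , ⊢⊤
      ; up     = λ _ _ a∈G a≤b → G-up⊢ a∈G (≤⇒⊢ a≤b)
      ; meet   = λ _ _ → G-meet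
      ; proper = λ (n , cn⊢⊥) → proj₂ (stage n) cn⊢⊥
      ; prime  = G-prime
      }

    G-meets : ∀ n → QCond L G (fam n)
    G-meets n a (_ , greatest) fam⊆G with meets (refinement n)
    ... | inj₁ (i , ⊢¬Xi) = ⊥-elim (PrimeFilter.not-both isL G-isPrimeFilter (fam⊆G i) (suc n , ⊢¬Xi))
    ... | inj₂ ⊢X         = suc n , ≤⇒⊢ (greatest _ (λ i → ⊢⇒≤ (⊢X i)))

  rasiowa-sikorski : ∀ χ → Coherent χ
                   → ∃ λ (G : Fm → Set) → IsPrimeFilter L G × (∀ n → QCond L G (fam n)) × G χ
  rasiowa-sikorski χ χ-coherent = G , G-isPrimeFilter , G-meets , (0 , ⊢-refl)
    where open Generic χ χ-coherent

-- Q-filters and the canonical frames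

module Canonical (lem : ExcludedMiddle (lsuc (lsuc 0ℓ))) {L : Fm → Set} (isL : IsPML L)
                 {I : Set} (enc : I → ℕ) (enc-injective : Injective _≡_ _≡_ enc)
                 (β : I → ℕ → Fm) (countable : (j : I) → CountableInst L (β j)) where
  open IsPML isL
  open Derivations isL

  infix 4 _∈_
  _∈_ : Fm → QS L β → Set
  ψ ∈ G = proj₁ G ψ

  module Q (G : QS L β) = PrimeFilter isL (proj₁ (proj₂ G))

  index : ℕ → Maybe I
  index k with decide lem (∃ λ j → enc j ≡ k)
  ... | yes (j , _) = just j
  ... | no  _       = nothing

  index-enc : ∀ j → index (enc j) ≡ just j
  index-enc j with decide lem (∃ λ j′ → enc j′ ≡ enc j)
  ... | yes (j′ , enc-j′≡enc-j) = cong just (enc-injective enc-j′≡enc-j)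
  ... | no  none                = ⊥-elim (none (j , refl))

  representative : Maybe I → ℕ → ℕ → Fm
  representative (just j) m i = subst (proj₁ (countable j) m) (β j i)
  representative nothing  m i = ⊤'

  -- Codes (0 , r) list the families of S₂, codes (suc _ , r) the representatives of the
  -- families of S₁; a code whose index k is not of the form enc j gives the harmless family ⊤'.
  family : ℕ × ℕ → ℕ → Fm
  family (zero  , r) y = instantiate y (enumFm r)
  family (suc _ , r)   = let k , m = unpair r in representative (index k) m

  qFamily : ℕ → ℕ → Fm
  qFamily = family ∘ unpair

  qFamily-instances : ∀ φ → ∃ λ n → qFamily n ≡ (λ y → instantiate y φ)
  qFamily-instances φ with enumFm-surjective φ
  ... | r , refl = pair 0 r , cong family (unpair-pair 0 r)

  qFamily-representatives : ∀ j m → ∃ λ n → qFamily n ≡ representative (just j) m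
  qFamily-representatives j m = pair 1 (pair (enc j) m) , (begin
    family (unpair (pair 1 (pair (enc j) m)))  ≡⟨ cong family (unpair-pair 1 (pair (enc j) m)) ⟩
    family (1 , pair (enc j) m)
      ≡⟨ cong (λ (k , m) → representative (index k) m) (unpair-pair (enc j) m) ⟩
    representative (index (enc j)) m           ≡⟨ cong (λ i → representative i m) (index-enc j) ⟩
    representative (just j) m                  ∎)
    where open ≡-Reasoning

  isQFilter : ∀ {G} → IsPrimeFilter L G → (∀ n → QCond L G (qFamily n)) → IsQFilter L β G
  isQFilter {G} pf meets = pf , S₁ , S₂
    where
    meets-family : ∀ {X} → (∃ λ n → qFamily n ≡ X) → QCond L G X
    meets-family (n , refl) = meets n
    S₁ : (j : I) (s : Sub) → QCond L G (λ i → subst s (β j i))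
    S₁ j s = let m , same = proj₂ (countable j) s in
             PrimeFilter.QCond-SameSet isL pf same (meets-family (qFamily-representatives j m))
    S₂ : (φ : Fm) → QCond L G (λ y → instantiate y φ)
    S₂ φ = meets-family (qFamily-instances φ)

  qFilter-through : ∀ χ → ¬ (χ ⊢ ⊥') → ∃ λ (G : QS L β) → χ ∈ G
  qFilter-through χ χ-coherent =
    let G , pf , meets , χ∈G = RasiowaSikorski.rasiowa-sikorski lem isL qFamily χ χ-coherent
    in (G , isQFilter pf meets) , χ∈G

  separation : ∀ {a b} → (∀ G → a ∈ G → b ∈ G) → a ⊢ b
  separation {a} {b} a⊆b = decidable-stable (decide lem _) λ a⊬b →
    let G , a∧¬b∈G = qFilter-through (a ∧' ¬' b) (a⊬b ∘ ∧¬⊢⊥⇒⊢)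
    in Q.not-both G (a⊆b G (Q.up⊢ G a∧¬b∈G ∧⊢ˡ)) (Q.up⊢ G a∧¬b∈G ∧⊢ʳ)

  provable-if-in-all : ∀ {a} → (∀ G → a ∈ G) → L a
  provable-if-in-all a∈ = ⊤⊢⇒L (separation (λ G _ → a∈ G))

  ∀-∈ : ∀ G ψ → (∀ y → instantiate y ψ ∈ G) → ∀' ψ ∈ G
  ∀-∈ (_ , _ , _ , S₂) ψ = S₂ ψ (∀' ψ) (∀-infimum ψ)

  BoxCharacterises : (QS L β → (QS L β → Set₂) → Set₂) → Set₃
  BoxCharacterises N = ∀ G (P : QS L β → Set₂) ψ → (∀ H → P H ⇔ₛ (ψ ∈ H)) → N G P ⇔ₛ (□ ψ ∈ G)

  module Model (N : QS L β → (QS L β → Set₂) → Set₂)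
               (N-ext : ∀ {w X Y} → ((u : QS L β) → X u ⇔ₛ Y u) → N w X → N w Y)
               (box : BoxCharacterises N) where

    frame : NFrame
    frame = record { W = QS L β ; N = N ; N-ext = N-ext }

    Domain : Set₂
    Domain = Lift _ ℕ

    interpretation : (n k : ℕ) → QS L β → Vec Domain n → Set₂
    interpretation n k G ds = Lift _ (atom n k (Vec.map lower ds) ∈ G)

    ⟦_⟧ᶜ : Fm → (ℕ → Domain) → QS L β → Set₂
    ⟦ φ ⟧ᶜ = ⟦_⟧ frame φ Domain interpretation

    instance-≡ : ∀ φ ρ d → instantiate (lower d) (rename (liftR (lower ∘ ρ)) φ)
                         ≡ rename (lower ∘ _∷ₐ_ frame d ρ) φ
    instance-≡ φ ρ d =
      trans (instantiate-rename (lower d) (lower ∘ ρ) φ)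
            (rename-cong (λ { zero → refl ; (suc i) → refl }) φ)

    truth : ∀ φ ρ G → ⟦ φ ⟧ᶜ ρ G ⇔ₛ (rename (lower ∘ ρ) φ ∈ G)
    truth ⊤'            ρ G = (λ _ → Q.top G) , _
    truth ⊥'            ρ G = (λ ()) , (λ ⊥∈G → ⊥-elim (Q.proper G ⊥∈G))
    truth (atom n k xs) ρ G =
        (λ (lift at∈G) → transport (λ ys → atom n k ys ∈ G) (sym (Vec.map-∘ lower ρ xs)) at∈G)
      , (λ at∈G → lift (transport (λ ys → atom n k ys ∈ G) (Vec.map-∘ lower ρ xs) at∈G))
    truth (φ ∧' ψ)      ρ G =
        (λ (⊨φ , ⊨ψ) → Q.meet G _ _ (proj₁ (truth φ ρ G) ⊨φ) (proj₁ (truth ψ ρ G) ⊨ψ))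
      , (λ φ∧ψ∈G → proj₂ (truth φ ρ G) (Q.up⊢ G φ∧ψ∈G ∧⊢ˡ) , proj₂ (truth ψ ρ G) (Q.up⊢ G φ∧ψ∈G ∧⊢ʳ))
    truth (¬' φ)        ρ G = forward , (λ ¬φ∈G ⊨φ → Q.not-both G (proj₁ (truth φ ρ G) ⊨φ) ¬φ∈G)
      where
      forward : ¬ ⟦ φ ⟧ᶜ ρ G → ¬' rename (lower ∘ ρ) φ ∈ G
      forward ⊭φ with Q.∈-or-¬∈ G (rename (lower ∘ ρ) φ)
      ... | inj₁ φ∈G  = ⊥-elim (⊭φ (proj₂ (truth φ ρ G) φ∈G))
      ... | inj₂ ¬φ∈G = ¬φ∈G
    truth (∀' φ)        ρ G = forward , backward
      where
      ψ = rename (liftR (lower ∘ ρ)) φ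
      forward : ⟦ ∀' φ ⟧ᶜ ρ G → ∀' ψ ∈ G
      forward ⊨φ = ∀-∈ G ψ λ y →
        transport (_∈ G) (sym (instance-≡ φ ρ (lift y))) (proj₁ (truth φ _ G) (⊨φ (lift y)))
      backward : ∀' ψ ∈ G → ⟦ ∀' φ ⟧ᶜ ρ G
      backward ∀ψ∈G d = proj₂ (truth φ _ G)
        (transport (_∈ G) (instance-≡ φ ρ d) (Q.up⊢ G ∀ψ∈G (cpc _ (inst (lower d)))))
    truth (□ φ)         ρ G = box G (⟦ φ ⟧ᶜ ρ) _ (truth φ ρ)

    complete : ∀ φ → Valid frame φ → L φ
    complete φ valid = provable-if-in-all λ G →
      transport (_∈ G) (rename-id φ)
        (proj₁ (truth φ lift G) (valid Domain (lift 0) interpretation lift G))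

  box-N₀ : BoxCharacterises (NFrame.N (FrmS L β))
  box-N₀ G P ψ P⇔ψ = forward , (λ □ψ∈G → ψ , □ψ∈G , P⇔ψ)
    where
    forward : NFrame.N (FrmS L β) G P → □ ψ ∈ G
    forward (x , □x∈G , P⇔x) = Q.up⊢ G □x∈G (□-cong (⊢-antisym
      (separation λ H → proj₁ (P⇔ψ H) ∘ proj₂ (P⇔x H))
      (separation λ H → proj₁ (P⇔x H) ∘ proj₂ (P⇔ψ H))))

  box-↑𝒩 : (𝒩 : NbhdSys L β) → NbhdCond L β 𝒩 → BoxCharacterises (NFrame.N (FrmSN L β 𝒩))
  box-↑𝒩 𝒩 cond G P ψ P⇔ψ = forward , backward
    where
    forward : NFrame.N (FrmSN L β 𝒩) G P → □ ψ ∈ G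
    forward (X , X∈𝒩G , X⊆P) with Q.∈-or-¬∈ G (□ ψ)
    ... | inj₁ □ψ∈G  = □ψ∈G
    ... | inj₂ ¬□ψ∈G =
      -- ¬□ψ ⊢ ◇¬ψ by RE, and the ◇-half of NbhdCond yields some H ∈ X with ¬ψ ∈ H
      let H , H∈X , ¬ψ∈H = proj₂ (cond G) (¬' ψ) (Q.up⊢ G ¬□ψ∈G (contraposition (□-cong ¬¬⇔))) X X∈𝒩G
      in ⊥-elim (Q.not-both H (proj₁ (P⇔ψ H) (X⊆P H H∈X)) ¬ψ∈H)
    backward : □ ψ ∈ G → NFrame.N (FrmSN L β 𝒩) G P
    backward □ψ∈G = let X , X∈𝒩G , X⊆ψ = proj₁ (cond G) ψ □ψ∈G in
                    X , X∈𝒩G , (λ H → proj₂ (P⇔ψ H) ∘ X⊆ψ H)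

sound-complete-if-canonical : ∀ {L} (𝔉 : NFrame) → InC L 𝔉 → (∀ φ → Valid 𝔉 φ → L φ)
                            → SoundComplete L
sound-complete-if-canonical 𝔉 𝔉∈𝒞 complete φ =
  (λ ⊢φ _ 𝔊∈𝒞 → proj₂ 𝔊∈𝒞 φ ⊢φ) , (λ valid → complete φ (valid 𝔉 𝔉∈𝒞))

corollary5p3 : ExcludedMiddle (Level.suc (Level.suc Level.zero))
    → (L : Fm → Set) → IsPML L → Consistent L
    → (I : Set) (enc : I → ℕ) → Injective _≡_ _≡_ enc
    → (α : I → Fm) (β : I → ℕ → Fm)
    → ((j : I) → Closed (α j)) → ((j : I) (i : ℕ) → Closed (β j i))
    → ((j : I) → Admits L (α j) (β j))
    → ((j : I) → CountableInst L (β j))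
    → (InC L (FrmS L β) → SoundComplete L)
      × (MT L → (𝒩 : NbhdSys L β) → NbhdCond L β 𝒩
           → InC L (FrmSN L β 𝒩) → SoundComplete L)
corollary5p3 lem L isL _ _ enc enc-injective _ β _ _ _ countable =
    (λ Frm∈𝒞 → sound-complete-if-canonical (FrmS L β) Frm∈𝒞 complete₀)
  , (λ _ 𝒩 cond Frm∈𝒞 → sound-complete-if-canonical (FrmSN L β 𝒩) Frm∈𝒞 (complete𝒩 𝒩 cond))
  where
  open Canonical lem isL enc enc-injective β countable

  complete₀ : ∀ φ → Valid (FrmS L β) φ → L φ
  complete₀ = Model.complete (NFrame.N (FrmS L β)) (λ {w} → NFrame.N-ext (FrmS L β) {w}) box-N₀

  complete𝒩 : ∀ 𝒩 → NbhdCond L β 𝒩 → ∀ φ → Valid (FrmSN L β 𝒩) φ → L φ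
  complete𝒩 𝒩 cond = Model.complete (NFrame.N (FrmSN L β 𝒩)) (λ {w} → NFrame.N-ext (FrmSN L β 𝒩) {w})
                                     (box-↑𝒩 𝒩 cond)
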